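{- Let $G$ be a signed cubic bipartite graph and let $\{F_1,F_2,F_3\}$ be a $1$-factorisation of $G$ (a partition of the edge set into three perfect matchings). Consider the three $2$-factors $F_1\cup F_2$, $F_1\cup F_3$ and $F_2\cup F_3$, each regarded as a signed graph with the signs inherited from $G$. If two of these three $2$-factors are balanced, then $G$ admits a nowhere-zero $4$-flow.
   Context: A signed graph is a graph in which each edge carries a sign $+$ or $-$. An orientation of a signed graph splits each edge into two half-edges, each directed independently; a positive edge has one half-edge directed away from and the other towards its end-vertex, while a negative edge has both half-edges directed towards, or both away from, their end-vertices. A nowhere-zero $k$-flow on a signed graph is an orientation together with an assignment of a value from $\{\pm1,\pm2,\dots,\pm(k-1)\}$ to each edge such that at every vertex the sum of incoming values equals the sum of outgoing values. A signed graph is balanced if every circuit contains an even number of negative edges (equivalently, it is switching equivalent to the all-positive signature, where switching at a vertex set $X$ reverses the signs of all edges between $X$ and its complement). -}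

module Defs where

open import Data.Nat using (ℕ; zero; suc; _<_; _<?_; s≤s)
open import Data.Nat.Divisibility using (_∣_)
open import Data.Integer using (ℤ; 0ℤ; -_) renaming (_+_ to _+ℤ_; _<_ to _<ℤ_)
open import Data.Integer as Z using ()
open import Data.Fin using (Fin; zero; suc; toℕ; fromℕ<)
open import Data.Fin.Properties using () renaming (_≟_ to _≟F_)
open import Data.Bool using (Bool; true; false; if_then_else_)
open import Data.Product using (Σ; _×_; _,_; ∃)
open import Data.Sum using (_⊎_)
open import Relation.Nullary using (¬_; yes; no; Dec)
open import Relation.Binary.PropositionalEquality using (_≡_; _≢_)
open import Function.Definitions using (Injective)

Σℕ : ∀ k → (Fin k → ℕ) → ℕ
Σℕ zero    f = 0
Σℕ (suc k) f = f zero Data.Nat.+ Σℕ k (λ i → f (suc i))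

Σℤ : ∀ k → (Fin k → ℤ) → ℤ
Σℤ zero    f = 0ℤ
Σℤ (suc k) f = f zero +ℤ Σℤ k (λ i → f (suc i))

data Sign : Set where
  pos neg : Sign

-- A finite signed (multi)graph: vertices Fin n, edges Fin m.
-- Each edge e has two half-edges (e , 0) and (e , 1); ends e i is the
-- end-vertex of the half-edge (e , i).
record SignedGraph : Set where
  field
    n    : ℕ
    m    : ℕ
    ends : Fin m → Fin 2 → Fin n
    sign : Fin m → Sign
open SignedGraph public

⌊_⌋ℕ : ∀ {P : Set} → Dec P → ℕ
⌊ yes _ ⌋ℕ = 1
⌊ no  _ ⌋ℕ = 0

halfEdgesAt : (G : SignedGraph) → (Fin (m G) → Bool) → Fin (n G) → ℕ
halfEdgesAt G sel v =
  Σℕ (m G) λ e → Σℕ 2 λ i → if sel e then ⌊ ends G e i ≟F v ⌋ℕ else 0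

degree : (G : SignedGraph) → Fin (n G) → ℕ
degree G v = halfEdgesAt G (λ _ → true) v

Cubic : SignedGraph → Set
Cubic G = ∀ v → degree G v ≡ 3

Bipartite : SignedGraph → Set
Bipartite G = Σ (Fin (n G) → Bool) λ c → ∀ e → c (ends G e zero) ≢ c (ends G e (suc zero))

⌊_⌋ᵇ : ∀ {P : Set} → Dec P → Bool
⌊ yes _ ⌋ᵇ = true
⌊ no  _ ⌋ᵇ = false

-- A 1-factorisation: a colouring of the edges by Fin 3 such that each colour
-- class is a perfect matching, i.e. every vertex is incident with exactly one
-- half-edge of each colour class.
OneFactorisation : (G : SignedGraph) → (Fin (m G) → Fin 3) → Set
OneFactorisation G φ = ∀ (j : Fin 3) (v : Fin (n G)) →
  halfEdgesAt G (λ e → ⌊ φ e ≟F j ⌋ᵇ) v ≡ 1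

csuc : ∀ {k} → Fin (suc k) → Fin (suc k)
csuc {k} i with toℕ i <? k
... | yes p = fromℕ< (s≤s p)
... | no  _ = zero

Joins : (G : SignedGraph) → Fin (m G) → Fin (n G) → Fin (n G) → Set
Joins G e x y = (ends G e zero ≡ x × ends G e (suc zero) ≡ y)
              ⊎ (ends G e zero ≡ y × ends G e (suc zero) ≡ x)

record Circuit (G : SignedGraph) : Set where
  field
    len   : ℕ
    vtx   : Fin (suc len) → Fin (n G)
    edg   : Fin (suc len) → Fin (m G)
    vinj  : Injective _≡_ _≡_ vtx
    einj  : Injective _≡_ _≡_ edg
    joins : ∀ i → Joins G (edg i) (vtx i) (vtx (csuc i))
open Circuit public

isNeg : Sign → ℕ
isNeg pos = 0
isNeg neg = 1

negCount : (G : SignedGraph) → Circuit G → ℕ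
negCount G C = Σℕ (suc (len C)) λ i → isNeg (sign G (edg C i))

-- The spanning subgraph of G with edge set {e | S e}, with inherited signs, is
-- balanced: every circuit of it (= circuit of G using only edges in S)
-- contains an even number of negative edges.
BalancedSub : (G : SignedGraph) → (Fin (m G) → Set) → Set
BalancedSub G S = ∀ (C : Circuit G) → (∀ i → S (edg C i)) → 2 ∣ negCount G C

-- Orientation: for each half-edge, true = directed towards its end-vertex,
-- false = directed away from it.
Orientation : SignedGraph → Set
Orientation G = Fin (m G) → Fin 2 → Bool

ValidOrientation : (G : SignedGraph) → Orientation G → Set
ValidOrientation G τ = ∀ e → Compat (sign G e) (τ e zero) (τ e (suc zero))
  where
  Compat : Sign → Bool → Bool → Set
  Compat pos a b = a ≢ b
  Compat neg a b = a ≡ b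

netFlow : (G : SignedGraph) → Orientation G → (Fin (m G) → ℤ) → Fin (n G) → ℤ
netFlow G τ f v = Σℤ (m G) λ e → Σℤ 2 λ i →
  if ⌊ ends G e i ≟F v ⌋ᵇ then (if τ e i then f e else - f e) else 0ℤ

NowhereZeroFlow : (G : SignedGraph) → ℕ → Set
NowhereZeroFlow G k =
  Σ (Orientation G) λ τ → Σ (Fin (m G) → ℤ) λ f →
    ValidOrientation G τ
    × (∀ e → f e ≢ 0ℤ × Z.∣ f e ∣ < k)
    × (∀ v → netFlow G τ f v ≡ 0ℤ)

In2Factor : ∀ {G : SignedGraph} → (Fin (m G) → Fin 3) → Fin 3 → Fin 3 → Fin (m G) → Set
In2Factor φ a b e = φ e ≡ a ⊎ φ e ≡ b

{-# OPTIONS --safe #-}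

-- By Harary's theorem a balanced 2-factor, say F_a ∪ F_b, can be switched to
-- all-positive. Adding the bipartition to the switching gives a labelling
-- Y : V → {±1} that is reversed across the positive edges of the 2-factor and
-- preserved across its negative ones. Hence, for a suitable orientation, the
-- integer flow whose inflow along an edge into its end u is Y(u) on F_a,
-- −Y(u) on F_b and 0 on F_c is well defined, and it is conserved because u
-- meets exactly one edge of each colour. Adding twice the analogous flow for
-- F_a ∪ F_c gives the values ±1 ± 2 on F_a, ±1 on F_b and ±2 on F_c: a
-- nowhere-zero 4-flow.
-- Harary's theorem is proved by growing the switching one edge at a time. An
-- edge closing a cycle is consistent because every closed walk of a balanced
-- subgraph has an even number of negative edges: cut at a repeated vertex, it
-- splits into two shorter closed walks, and without repeated vertices it is a
-- circuit.

module Submission where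

open import Defs

open import Algebra.Properties.CommutativeSemigroup as CommSemigroupProps using ()
open import Data.Bool using (Bool; true; false; if_then_else_)
open import Data.Empty using (⊥-elim)
open import Data.Fin using (Fin; zero; suc; toℕ; fromℕ; inject₁)
open import Data.Fin.Properties
  using (toℕ-injective; toℕ-fromℕ; toℕ-fromℕ<; toℕ-inject₁; toℕ<n; any?; all?)
  renaming (_≟_ to _≟F_)
open import Data.Fin.Relation.Unary.Top using (view; ‵fromℕ; ‵inject₁)
open import Data.Integer using (ℤ; +_; 0ℤ; 1ℤ; -1ℤ; -_; _+_; _*_; _-_; ∣_∣)
open import Data.Integer.Properties as ℤ
  using (pos-+; neg-distrib-+; neg-distribʳ-*; *-zeroʳ; *-distribˡ-+; *-comm)
open import Data.List using (List; []; _∷_; allFin)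
open import Data.List.Membership.Propositional using (_∈_)
open import Data.List.Membership.Propositional.Properties using (∈-allFin)
open import Data.List.Relation.Unary.Any using (here; there)
open import Data.Maybe using (Maybe; just; nothing)
open import Data.Nat as ℕ using (ℕ; zero; suc; _<_; _≤_; z≤n; s≤s; z<s; parity)
open import Data.Nat.Divisibility using (_∣_; divides)
open import Data.Nat.Induction using (<-wellFounded)
open import Data.Nat.Properties using (<-irrefl; m<m+n; m≤n+m; m<n⇒m<1+n; ≤ᵇ⇒≤)
open import Data.Parity.Base using (Parity; 0ℙ; 1ℙ) renaming (_+_ to _⊕_)
open import Data.Parity.Properties as ℙ using (+-*-commutativeRing)
open import Data.Product using (Σ; _×_; _,_; proj₁; proj₂)
open import Data.Sum using (_⊎_; inj₁; inj₂; [_,_]′)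
open import Function using (_∘_)
open import Function.Definitions using (Injective)
open import Induction.WellFounded using (Acc; acc)
open import Relation.Nullary using (¬_; ¬?; Dec; yes; no)
open import Relation.Nullary.Decidable using (from-yes; _→-dec_; _⊎-dec_)
open import Relation.Unary using (Decidable)
open import Relation.Binary.PropositionalEquality
  using (_≡_; _≢_; refl; sym; trans; cong; cong₂; subst; module ≡-Reasoning)
open import Tactic.RingSolver using (solve-∀)
open import Tactic.RingSolver.Core.AlmostCommutativeRing
  using (AlmostCommutativeRing; fromCommutativeRing)

open CommSemigroupProps ℤ.+-commutativeSemigroup using () renaming (interchange to +-interchange)
open CommSemigroupProps ℙ.+-commutativeSemigroup using () renaming (interchange to ⊕-interchange)

csuc-fromℕ : ∀ k → csuc (fromℕ k) ≡ zero
csuc-fromℕ k with toℕ (fromℕ k) ℕ.<? k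
... | yes k<k = ⊥-elim (<-irrefl (toℕ-fromℕ k) k<k)
... | no _    = refl

csuc-inject₁ : ∀ {k} (i : Fin k) → csuc (inject₁ i) ≡ suc i
csuc-inject₁ {k} i with toℕ (inject₁ i) ℕ.<? k
... | yes i<k = toℕ-injective (trans (toℕ-fromℕ< (s≤s i<k)) (cong suc (toℕ-inject₁ i)))
... | no  i≮k = ⊥-elim (i≮k (subst (_< k) (sym (toℕ-inject₁ i)) (toℕ<n i)))

cyclic-shift : ∀ {k} {A : Set} (f : Fin (suc (suc k)) → A) → f zero ≡ f (fromℕ (suc k)) →
               ∀ i → f (suc i) ≡ f (inject₁ (csuc i))
cyclic-shift {k} f closed i with view i
... | ‵fromℕ     = trans (sym closed) (cong (f ∘ inject₁) (sym (csuc-fromℕ k)))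
... | ‵inject₁ j = cong (f ∘ inject₁) (sym (csuc-inject₁ j))

csuc∘csuc-≢ : ∀ {k} → 2 ≤ k → (i : Fin (suc k)) → csuc (csuc i) ≢ i
csuc∘csuc-≢ {suc (suc k)} (s≤s (s≤s _)) i with view i
... | ‵fromℕ rewrite csuc-fromℕ (suc (suc k)) = λ ()
... | ‵inject₁ j rewrite csuc-inject₁ j with view j
...   | ‵fromℕ rewrite csuc-fromℕ (suc (suc k)) = λ ()
...   | ‵inject₁ j′ rewrite csuc-inject₁ (suc j′) = λ eq →
  two-more (trans (cong toℕ eq) (trans (toℕ-inject₁ (inject₁ j′)) (toℕ-inject₁ j′)))
  where
  two-more : ∀ {t} → suc (suc t) ≢ t
  two-more ()

ℙ-ring : AlmostCommutativeRing _ _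
ℙ-ring = fromCommutativeRing +-*-commutativeRing isZero
  where
  isZero : ∀ p → Maybe (0ℙ ≡ p)
  isZero 0ℙ = just refl
  isZero 1ℙ = nothing

even⇒parity≡0ℙ : ∀ {k} → 2 ∣ k → parity k ≡ 0ℙ
even⇒parity≡0ℙ (divides q refl) = trans (ℙ.*-homo-* q 2) (ℙ.*-zeroʳ (parity q))

⊕≡0ℙ⇒≡ : ∀ {p q} → p ⊕ q ≡ 0ℙ → p ≡ q
⊕≡0ℙ⇒≡ {0ℙ} {0ℙ} _ = refl
⊕≡0ℙ⇒≡ {1ℙ} {1ℙ} _ = refl

⊕-shift-cancel : ∀ p q d → (p ⊕ d) ⊕ (q ⊕ d) ≡ p ⊕ q
⊕-shift-cancel = solve-∀ ℙ-ring

signParity : Sign → Parity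
signParity s = parity (isNeg s)

-- switching at the vertices with π v ≡ 1ℙ turns every edge of S positive
Switching : (G : SignedGraph) → (Fin (m G) → Set) → (Fin (n G) → Parity) → Set
Switching G S π = ∀ e → S e →
  π (ends G e zero) ⊕ π (ends G e (suc zero)) ≡ signParity (sign G e)

-- Harary's theorem

joins-unique : ∀ {G : SignedGraph} {e x y x′ y′} → Joins G e x y → Joins G e x′ y′ →
               (x ≡ x′ × y ≡ y′) ⊎ (x ≡ y′ × y ≡ x′)
joins-unique (inj₁ (p , q)) (inj₁ (p′ , q′)) = inj₁ (trans (sym p) p′ , trans (sym q) q′)
joins-unique (inj₁ (p , q)) (inj₂ (p′ , q′)) = inj₂ (trans (sym p) p′ , trans (sym q) q′)
joins-unique (inj₂ (p , q)) (inj₁ (p′ , q′)) = inj₂ (trans (sym q) q′ , trans (sym p) p′)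
joins-unique (inj₂ (p , q)) (inj₂ (p′ , q′)) = inj₁ (trans (sym q) q′ , trans (sym p) p′)

cycle-edges-injective : ∀ {G k} → 2 ≤ k →
  (vtx : Fin (suc k) → Fin (n G)) (edg : Fin (suc k) → Fin (m G)) →
  Injective _≡_ _≡_ vtx → (∀ i → Joins G (edg i) (vtx i) (vtx (csuc i))) →
  Injective _≡_ _≡_ edg
cycle-edges-injective {G} 2≤k vtx edg vtx-inj joins {i} {j} edg-eq
  with joins-unique {G} (joins i) (subst (λ e → Joins G e _ _) (sym edg-eq) (joins j))
... | inj₁ (same , _)     = vtx-inj same
... | inj₂ (i≡sj , si≡j) =
  ⊥-elim (csuc∘csuc-≢ 2≤k j (trans (cong csuc (sym (vtx-inj i≡sj))) (vtx-inj si≡j)))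

module Harary (G : SignedGraph) (S : Fin (m G) → Set) where

  data Walk : Fin (n G) → Fin (n G) → Set where
    nil  : ∀ {x} → Walk x x
    step : ∀ {x y z} e → S e → Joins G e x y → Walk y z → Walk x z

  length : ∀ {x z} → Walk x z → ℕ
  length nil            = 0
  length (step _ _ _ W) = suc (length W)

  vertex : ∀ {x z} (W : Walk x z) → Fin (suc (length W)) → Fin (n G)
  vertex {x} _            zero    = x
  vertex (step _ _ _ W) (suc i) = vertex W i

  departure : ∀ {x z} (W : Walk x z) → Fin (length W) → Fin (n G)
  departure W i = vertex W (inject₁ i)

  edge : ∀ {x z} (W : Walk x z) → Fin (length W) → Fin (m G)
  edge (step e _ _ _) zero    = e
  edge (step _ _ _ W) (suc i) = edge W i

  walkParity : ∀ {x z} → Walk x z → Parity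
  walkParity nil            = 0ℙ
  walkParity (step e _ _ W) = signParity (sign G e) ⊕ walkParity W

  _++_ : ∀ {x y z} → Walk x y → Walk y z → Walk x z
  nil          ++ B = B
  step e s j A ++ B = step e s j (A ++ B)

  length-++ : ∀ {x y z} (A : Walk x y) (B : Walk y z) → length (A ++ B) ≡ length A ℕ.+ length B
  length-++ nil            B = refl
  length-++ (step _ _ _ A) B = cong suc (length-++ A B)

  walkParity-++ : ∀ {x y z} (A : Walk x y) (B : Walk y z) →
                  walkParity (A ++ B) ≡ walkParity A ⊕ walkParity B
  walkParity-++ nil            B = refl
  walkParity-++ (step e _ _ A) B = trans (cong (signParity (sign G e) ⊕_) (walkParity-++ A B))
                                       (sym (ℙ.+-assoc (signParity (sign G e)) _ _))

  walkParity≡parity-negatives : ∀ {x z} (W : Walk x z) →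
    walkParity W ≡ parity (Σℕ (length W) λ i → isNeg (sign G (edge W i)))
  walkParity≡parity-negatives nil            = refl
  walkParity≡parity-negatives (step e _ _ W) =
    trans (cong (signParity (sign G e) ⊕_) (walkParity≡parity-negatives W))
          (sym (ℙ.+-homo-+ (isNeg (sign G e)) _))

  vertex-last : ∀ {x z} (W : Walk x z) → vertex W (fromℕ (length W)) ≡ z
  vertex-last nil            = refl
  vertex-last (step _ _ _ W) = vertex-last W

  edge-joins : ∀ {x z} (W : Walk x z) i → Joins G (edge W i) (departure W i) (vertex W (suc i))
  edge-joins (step _ _ j _) zero    = j
  edge-joins (step _ _ _ W) (suc i) = edge-joins W i

  edge-in-S : ∀ {x z} (W : Walk x z) i → S (edge W i)
  edge-in-S (step _ s _ _) zero    = s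
  edge-in-S (step _ _ _ W) (suc i) = edge-in-S W i

  module _ {u y e} (s : S e) (j : Joins G e u y) (W : Walk y u) where

    private
      C : Walk u u
      C = step e s j W

    closedWalk-joins : ∀ i → Joins G (edge C i) (departure C i) (departure C (csuc i))
    closedWalk-joins i =
      subst (Joins G _ _) (cyclic-shift (vertex C) (sym (vertex-last C)) i) (edge-joins C i)

    toCircuit : Injective _≡_ _≡_ (departure C) → Injective _≡_ _≡_ (edge C) → Circuit G
    toCircuit vinj einj = record
      { len = length W ; vtx = departure C ; edg = edge C
      ; vinj = vinj ; einj = einj ; joins = closedWalk-joins }

    circuit-even : BalancedSub G S →
      (vinj : Injective _≡_ _≡_ (departure C)) (einj : Injective _≡_ _≡_ (edge C)) →
      walkParity C ≡ 0ℙ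
    circuit-even balanced vinj einj =
      trans (walkParity≡parity-negatives C)
            (even⇒parity≡0ℙ (balanced (toCircuit vinj einj) (edge-in-S C)))

  simpleClosedWalk-even : BalancedSub G S → ∀ {u} (W : Walk u u) →
                          Injective _≡_ _≡_ (departure W) → walkParity W ≡ 0ℙ
  simpleClosedWalk-even _ nil _ = refl
  simpleClosedWalk-even balanced (step e s j nil) vinj =
    circuit-even s j nil balanced vinj λ { {zero} {zero} _ → refl }
  simpleClosedWalk-even balanced (step e s j (step e′ s′ j′ nil)) vinj with e ≟F e′
  ... | yes refl = trans (cong (ν ⊕_) (ℙ.+-identityʳ ν)) (ℙ.p+p≡0ℙ ν)
    where ν = signParity (sign G e)
  ... | no e≢e′ = circuit-even s j (step e′ s′ j′ nil) balanced vinj λ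
    { {zero}     {zero}     _  → refl
    ; {zero}     {suc zero} eq → ⊥-elim (e≢e′ eq)
    ; {suc zero} {zero}     eq → ⊥-elim (e≢e′ (sym eq))
    ; {suc zero} {suc zero} _  → refl }
  simpleClosedWalk-even balanced (step e s j W@(step _ _ _ (step _ _ _ _))) vinj =
    circuit-even s j W balanced vinj
      (cycle-edges-injective {G} (s≤s (s≤s z≤n)) _ _ vinj (closedWalk-joins s j W))

  record Shortcut {x z} (W : Walk x z) : Set where
    field
      pivot        : Fin (n G)
      before       : Walk x pivot
      loop         : Walk pivot pivot
      after        : Walk pivot z
      splits       : before ++ (loop ++ after) ≡ W
      loop-shorter : length loop < length W
      rest-shorter : length (before ++ after) < length W

  splitAt : ∀ {x z t} (W : Walk x z) (i : Fin (length W)) → departure W i ≡ t →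
            Σ (Walk x t) λ A → Σ (Walk t z) λ B → A ++ B ≡ W × 0 < length B
  splitAt W@(step _ _ _ _) zero refl = nil , W , refl , z<s
  splitAt (step e s j W) (suc i) eq with splitAt W i eq
  ... | A , B , A++B≡W , 0<B = step e s j A , B , cong (step e s j) A++B≡W , 0<B

  returnShortcut : ∀ {x y z e} (s : S e) (j : Joins G e x y) (W : Walk y z) i →
                   departure W i ≡ x → Shortcut (step e s j W)
  returnShortcut {x} {e = e} s j W i revisit with splitAt W i revisit
  ... | A , B , refl , 0<B = record
    { pivot = x ; before = nil ; loop = step e s j A ; after = B ; splits = refl
    ; loop-shorter = s≤s (subst (length A <_) |A++B| (m<m+n (length A) 0<B))
    ; rest-shorter = s≤s (subst (length B ≤_) |A++B| (m≤n+m (length B) (length A))) }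
    where
    |A++B| : length A ℕ.+ length B ≡ length (A ++ B)
    |A++B| = sym (length-++ A B)

  prependShortcut : ∀ {x y z e} (s : S e) (j : Joins G e x y) {W : Walk y z} →
                    Shortcut W → Shortcut (step e s j W)
  prependShortcut s j sc = record
    { pivot = pivot ; before = step _ s j before ; loop = loop ; after = after
    ; splits = cong (step _ s j) splits
    ; loop-shorter = m<n⇒m<1+n loop-shorter
    ; rest-shorter = s≤s rest-shorter }
    where open Shortcut sc

  decompose : ∀ {x z} (W : Walk x z) → Injective _≡_ _≡_ (departure W) ⊎ Shortcut W
  decompose nil = inj₁ λ { {()} }
  decompose (step {x} e s j W) with decompose W
  ... | inj₂ sc = inj₂ (prependShortcut s j sc)
  ... | inj₁ simple with any? (λ i → departure W i ≟F x)
  ...   | yes (i , revisit) = inj₂ (returnShortcut s j W i revisit)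
  ...   | no ¬revisit = inj₁ λ
    { {zero}  {zero}  _  → refl
    ; {zero}  {suc b} eq → ⊥-elim (¬revisit (b , sym eq))
    ; {suc a} {zero}  eq → ⊥-elim (¬revisit (a , eq))
    ; {suc a} {suc b} eq → cong suc (simple eq) }

  closedWalk-even : BalancedSub G S → ∀ {u} (W : Walk u u) → walkParity W ≡ 0ℙ
  closedWalk-even balanced W = go W (<-wellFounded (length W))
    where
    open ≡-Reasoning
    go : ∀ {u} (W : Walk u u) → Acc _<_ (length W) → walkParity W ≡ 0ℙ
    go W (acc shorter) with decompose W
    ... | inj₁ simple = simpleClosedWalk-even balanced W simple
    ... | inj₂ record { before = A ; loop = B ; after = C ; splits = refl
                      ; loop-shorter = B<W ; rest-shorter = AC<W } = begin
      walkParity (A ++ (B ++ C))                   ≡⟨ walkParity-++ A (B ++ C) ⟩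
      walkParity A ⊕ walkParity (B ++ C)           ≡⟨ cong (walkParity A ⊕_) (walkParity-++ B C) ⟩
      walkParity A ⊕ (walkParity B ⊕ walkParity C) ≡⟨ cong (λ p → walkParity A ⊕ (p ⊕ walkParity C))
                                                         (go B (shorter B<W)) ⟩
      walkParity A ⊕ walkParity C                  ≡⟨ sym (walkParity-++ A C) ⟩
      walkParity (A ++ C)                          ≡⟨ go (A ++ C) (shorter AC<W) ⟩
      0ℙ                                           ∎

  record PartialSwitching (L : List (Fin (m G))) : Set where
    field
      component : Fin (n G) → Fin (n G)
      potential : Fin (n G) → Parity
      respects  : ∀ {e} → e ∈ L → S e →
                  component (ends G e zero) ≡ component (ends G e (suc zero)) ×
                  potential (ends G e zero) ⊕ potential (ends G e (suc zero)) ≡ signParity (sign G e)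
      linked    : ∀ {x y} → component x ≡ component y →
                  Σ (Walk x y) λ W → walkParity W ≡ potential x ⊕ potential y

  trivialSwitching : PartialSwitching []
  trivialSwitching = record
    { component = λ x → x ; potential = λ _ → 0ℙ
    ; respects = λ () ; linked = λ { refl → nil , refl } }

  skipEdge : ∀ {L e} → PartialSwitching L → ¬ S e → PartialSwitching (e ∷ L)
  skipEdge P ¬s = record
    { component = component ; potential = potential ; linked = linked
    ; respects = λ { (here refl) s → ⊥-elim (¬s s) ; (there e∈L) → respects e∈L } }
    where open PartialSwitching P

  module _ {L e} (P : PartialSwitching L) (s : S e) where
    open PartialSwitching P

    private
      u v : Fin (n G)
      u = ends G e zero
      v = ends G e (suc zero)

    closeCycle : BalancedSub G S → component u ≡ component v → PartialSwitching (e ∷ L)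
    closeCycle balanced same = record
      { component = component ; potential = potential ; linked = linked
      ; respects = λ { (here refl) _ → same , consistent ; (there e∈L) → respects e∈L } }
      where
      consistent : potential u ⊕ potential v ≡ signParity (sign G e)
      consistent with linked (sym same)
      ... | W , pW = sym (⊕≡0ℙ⇒≡ (begin
        signParity (sign G e) ⊕ (potential u ⊕ potential v)
          ≡⟨ cong (signParity (sign G e) ⊕_) (trans (ℙ.+-comm (potential u) (potential v)) (sym pW)) ⟩
        walkParity (step e s (inj₁ (refl , refl)) W)
          ≡⟨ closedWalk-even balanced (step e s (inj₁ (refl , refl)) W) ⟩
        0ℙ ∎))
        where open ≡-Reasoning

    module _ (apart : component u ≢ component v) where

      private
        ν δ : Parity
        ν = signParity (sign G e)
        δ = potential u ⊕ potential v ⊕ ν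

        component′ : Fin (n G) → Fin (n G)
        component′ x with component x ≟F component v
        ... | yes _ = component u
        ... | no  _ = component x

        potential′ : Fin (n G) → Parity
        potential′ x with component x ≟F component v
        ... | yes _ = potential x ⊕ δ
        ... | no  _ = potential x

        moved : ∀ {x} → component x ≡ component v →
                component′ x ≡ component u × potential′ x ≡ potential x ⊕ δ
        moved {x} inside with component x ≟F component v
        ... | yes _       = refl , refl
        ... | no  outside = ⊥-elim (outside inside)

        kept : ∀ {x} → component x ≢ component v →
               component′ x ≡ component x × potential′ x ≡ potential x
        kept {x} outside with component x ≟F component v
        ... | yes inside = ⊥-elim (outside inside)
        ... | no  _      = refl , refl

        within : ∀ {x y} → component x ≡ component y →
                 component′ x ≡ component′ y × potential′ x ⊕ potential′ y ≡ potential x ⊕ potential y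
        within {x} {y} same = by-side (component x ≟F component v)
          where
          by-side : Dec (component x ≡ component v) →
                    component′ x ≡ component′ y × potential′ x ⊕ potential′ y ≡ potential x ⊕ potential y
          by-side (yes inside) =
            let cx , px = moved inside ; cy , py = moved (trans (sym same) inside)
            in trans cx (sym cy) , trans (cong₂ _⊕_ px py) (⊕-shift-cancel (potential x) (potential y) δ)
          by-side (no outside) =
            let cx , px = kept outside ; cy , py = kept (λ c → outside (trans same c))
            in trans cx (trans same (sym cy)) , cong₂ _⊕_ px py

        respects′ : ∀ {e′} → e′ ∈ e ∷ L → S e′ →
          component′ (ends G e′ zero) ≡ component′ (ends G e′ (suc zero)) ×
          potential′ (ends G e′ zero) ⊕ potential′ (ends G e′ (suc zero)) ≡ signParity (sign G e′)
        respects′ (here refl) _ =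
          trans (proj₁ (kept apart)) (sym (proj₁ (moved refl))) ,
          trans (cong₂ _⊕_ (proj₂ (kept apart)) (proj₂ (moved refl)))
                (consistent (potential u) (potential v) ν)
          where
          consistent : ∀ p q n → p ⊕ (q ⊕ (p ⊕ q ⊕ n)) ≡ n
          consistent = solve-∀ ℙ-ring
        respects′ (there e′∈L) s′ =
          let same , consistent = respects e′∈L s′ ; same′ , consistent′ = within same
          in same′ , trans consistent′ consistent

        linked′ : ∀ {x y} → component′ x ≡ component′ y →
                  Σ (Walk x y) λ W → walkParity W ≡ potential′ x ⊕ potential′ y
        linked′ {x} {y} same′ with component x ≟F component v | component y ≟F component v
        ... | yes x-in | yes y-in =
          let W , pW = linked (trans x-in (sym y-in))
          in W , trans pW (sym (⊕-shift-cancel (potential x) (potential y) δ))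
        ... | no _ | no _ = linked same′
        ... | yes x-in | no _ =
          let W₁ , p₁ = linked x-in ; W₂ , p₂ = linked same′
          in W₁ ++ step e s (inj₂ (refl , refl)) W₂ ,
             trans (walkParity-++ W₁ _)
                   (trans (cong₂ (λ a b → a ⊕ (ν ⊕ b)) p₁ p₂)
                          (via-v (potential x) (potential y) (potential u) (potential v) ν))
          where
          via-v : ∀ x y p q n → (x ⊕ q) ⊕ (n ⊕ (p ⊕ y)) ≡ (x ⊕ (p ⊕ q ⊕ n)) ⊕ y
          via-v = solve-∀ ℙ-ring
        ... | no _ | yes y-in =
          let W₁ , p₁ = linked same′ ; W₂ , p₂ = linked (sym y-in)
          in W₁ ++ step e s (inj₁ (refl , refl)) W₂ ,
             trans (walkParity-++ W₁ _)
                   (trans (cong₂ (λ a b → a ⊕ (ν ⊕ b)) p₁ p₂)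
                          (via-u (potential x) (potential y) (potential u) (potential v) ν))
          where
          via-u : ∀ x y p q n → (x ⊕ p) ⊕ (n ⊕ (q ⊕ y)) ≡ x ⊕ (y ⊕ (p ⊕ q ⊕ n))
          via-u = solve-∀ ℙ-ring

      joinComponents : PartialSwitching (e ∷ L)
      joinComponents = record
        { component = component′ ; potential = potential′ ; respects = respects′ ; linked = linked′ }

  addEdge : Decidable S → BalancedSub G S → ∀ {L} → PartialSwitching L → ∀ e →
            PartialSwitching (e ∷ L)
  addEdge S? balanced P e with S? e
  ... | no ¬s = skipEdge P ¬s
  ... | yes s with PartialSwitching.component P (ends G e zero)
                    ≟F PartialSwitching.component P (ends G e (suc zero))
  ...   | yes same  = closeCycle P s balanced same
  ...   | no  apart = joinComponents P s apart

  switchingOn : Decidable S → BalancedSub G S → ∀ L → PartialSwitching L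
  switchingOn S? balanced []      = trivialSwitching
  switchingOn S? balanced (e ∷ L) = addEdge S? balanced (switchingOn S? balanced L) e

balanced⇒switching : ∀ G (S : Fin (m G) → Set) → Decidable S → BalancedSub G S →
                     Σ (Fin (n G) → Parity) (Switching G S)
balanced⇒switching G S S? balanced = potential , λ e → proj₂ ∘ respects (∈-allFin e)
  where
  open Harary G S
  open PartialSwitching (switchingOn S? balanced (allFin (m G)))

-- Integer flows

Σℤ-cong : ∀ k {f g : Fin k → ℤ} → (∀ i → f i ≡ g i) → Σℤ k f ≡ Σℤ k g
Σℤ-cong zero    f≗g = refl
Σℤ-cong (suc k) f≗g = cong₂ _+_ (f≗g zero) (Σℤ-cong k (f≗g ∘ suc))

Σℤ-+ : ∀ k (f g : Fin k → ℤ) → Σℤ k (λ i → f i + g i) ≡ Σℤ k f + Σℤ k g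
Σℤ-+ zero    f g = refl
Σℤ-+ (suc k) f g = trans (cong (_+_ (f zero + g zero)) (Σℤ-+ k (f ∘ suc) (g ∘ suc)))
                         (+-interchange (f zero) (g zero) _ _)

Σℤ-* : ∀ k c (f : Fin k → ℤ) → Σℤ k (λ i → c * f i) ≡ c * Σℤ k f
Σℤ-* zero    c f = sym (*-zeroʳ c)
Σℤ-* (suc k) c f = trans (cong (_+_ (c * f zero)) (Σℤ-* k c (f ∘ suc)))
                         (sym (*-distribˡ-+ c (f zero) _))

Σℤ-difference : ∀ k (f g : Fin k → ℕ) → Σℤ k (λ i → + f i - + g i) ≡ + Σℕ k f - + Σℕ k g
Σℤ-difference zero    f g = refl
Σℤ-difference (suc k) f g = begin
  (+ f zero - + g zero) + Σℤ k (λ i → + f (suc i) - + g (suc i))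
    ≡⟨ cong (_+_ (+ f zero - + g zero)) (Σℤ-difference k (f ∘ suc) (g ∘ suc)) ⟩
  (+ f zero - + g zero) + (+ F - + G)
    ≡⟨ +-interchange (+ f zero) (- + g zero) (+ F) (- + G) ⟩
  (+ f zero + + F) + (- + g zero + - + G)
    ≡⟨ cong₂ _+_ (sym (pos-+ (f zero) F))
                 (trans (sym (neg-distrib-+ (+ g zero) (+ G))) (cong -_ (sym (pos-+ (g zero) G)))) ⟩
  + (f zero ℕ.+ F) - + (g zero ℕ.+ G) ∎
  where
  open ≡-Reasoning
  F = Σℕ k (f ∘ suc)
  G = Σℕ k (g ∘ suc)

atVertex : (G : SignedGraph) → Fin (n G) → (Fin (m G) → Fin 2 → ℤ) → Fin (m G) → Fin 2 → ℤ
atVertex G v h e i = if ⌊ ends G e i ≟F v ⌋ᵇ then h e i else 0ℤ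

halfEdgeSum : (G : SignedGraph) → (Fin (m G) → Fin 2 → ℤ) → Fin (n G) → ℤ
halfEdgeSum G h v = Σℤ (m G) λ e → Σℤ 2 (atVertex G v h e)

module _ (G : SignedGraph) (v : Fin (n G)) where

  halfEdgeSum-cong : ∀ {h h′} → (∀ e i → h e i ≡ h′ e i) →
                     halfEdgeSum G h v ≡ halfEdgeSum G h′ v
  halfEdgeSum-cong h≗h′ = Σℤ-cong (m G) λ e → Σℤ-cong 2 λ i →
    cong (λ x → if ⌊ ends G e i ≟F v ⌋ᵇ then x else 0ℤ) (h≗h′ e i)

  halfEdgeSum-+ : ∀ h h′ →
    halfEdgeSum G (λ e i → h e i + h′ e i) v ≡ halfEdgeSum G h v + halfEdgeSum G h′ v
  halfEdgeSum-+ h h′ =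
    trans (Σℤ-cong (m G) λ e →
             trans (Σℤ-cong 2 (split e)) (Σℤ-+ 2 (atVertex G v h e) (atVertex G v h′ e)))
          (Σℤ-+ (m G) (λ e → Σℤ 2 (atVertex G v h e)) (λ e → Σℤ 2 (atVertex G v h′ e)))
    where
    split : ∀ e i → atVertex G v (λ e i → h e i + h′ e i) e i ≡
                    atVertex G v h e i + atVertex G v h′ e i
    split e i with ⌊ ends G e i ≟F v ⌋ᵇ
    ... | true  = refl
    ... | false = refl

  halfEdgeSum-* : ∀ c h → halfEdgeSum G (λ e i → c * h e i) v ≡ c * halfEdgeSum G h v
  halfEdgeSum-* c h =
    trans (Σℤ-cong (m G) λ e → trans (Σℤ-cong 2 (scale e)) (Σℤ-* 2 c (atVertex G v h e)))
          (Σℤ-* (m G) c (λ e → Σℤ 2 (atVertex G v h e)))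
    where
    scale : ∀ e i → atVertex G v (λ e i → c * h e i) e i ≡ c * atVertex G v h e i
    scale e i with ⌊ ends G e i ≟F v ⌋ᵇ
    ... | true  = refl
    ... | false = sym (*-zeroʳ c)

  halfEdgeSum-endpoint : ∀ (Y : Fin (n G) → ℤ) h →
    halfEdgeSum G (λ e i → Y (ends G e i) * h e i) v ≡ Y v * halfEdgeSum G h v
  halfEdgeSum-endpoint Y h =
    trans (Σℤ-cong (m G) λ e → Σℤ-cong 2 (endpoint e)) (halfEdgeSum-* (Y v) h)
    where
    endpoint : ∀ e i → atVertex G v (λ e i → Y (ends G e i) * h e i) e i ≡
                       atVertex G v (λ e i → Y v * h e i) e i
    endpoint e i with ends G e i ≟F v
    ... | yes at-v = cong (λ w → Y w * h e i) at-v
    ... | no  _    = refl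

-- netFlow G τ f v unfolds to halfEdgeSum G (inflow G τ f) v
inflow : (G : SignedGraph) → Orientation G → (Fin (m G) → ℤ) → Fin (m G) → Fin 2 → ℤ
inflow G τ f e i = if τ e i then f e else - f e

netFlow-+ : ∀ G τ (f g : Fin (m G) → ℤ) v →
            netFlow G τ (λ e → f e + g e) v ≡ netFlow G τ f v + netFlow G τ g v
netFlow-+ G τ f g v =
  trans (halfEdgeSum-cong G v inflow-+) (halfEdgeSum-+ G v (inflow G τ f) (inflow G τ g))
  where
  inflow-+ : ∀ e i → inflow G τ (λ e → f e + g e) e i ≡ inflow G τ f e i + inflow G τ g e i
  inflow-+ e i with τ e i
  ... | true  = refl
  ... | false = neg-distrib-+ (f e) (g e)

netFlow-* : ∀ G τ k (f : Fin (m G) → ℤ) v → netFlow G τ (λ e → k * f e) v ≡ k * netFlow G τ f v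
netFlow-* G τ k f v = trans (halfEdgeSum-cong G v inflow-*) (halfEdgeSum-* G v k (inflow G τ f))
  where
  inflow-* : ∀ e i → inflow G τ (λ e → k * f e) e i ≡ k * inflow G τ f e i
  inflow-* e i with τ e i
  ... | true  = refl
  ... | false = neg-distribʳ-* k (f e)

negativeᵇ : Sign → Bool
negativeᵇ pos = false
negativeᵇ neg = true

canonicalOrientation : (G : SignedGraph) → Orientation G
canonicalOrientation G e zero       = true
canonicalOrientation G e (suc zero) = negativeᵇ (sign G e)

canonicalOrientation-valid : (G : SignedGraph) → ValidOrientation G (canonicalOrientation G)
canonicalOrientation-valid G e with sign G e
... | pos = λ ()
... | neg = refl

-- under canonicalOrientation, inflow x at the first end of e is inflow farEnd (sign G e) x
-- at the second end
farEnd : Sign → ℤ → ℤ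
farEnd s x = if negativeᵇ s then x else - x

farEnd-* : ∀ s k x → farEnd s (k * x) ≡ k * farEnd s x
farEnd-* pos k x = neg-distribʳ-* k x
farEnd-* neg k x = refl

IsPotential : (G : SignedGraph) → (Fin (m G) → Set) → (Fin (n G) → ℤ) → Set
IsPotential G S Y = ∀ e → S e → Y (ends G e (suc zero)) ≡ farEnd (sign G e) (Y (ends G e zero))

potentialFlow : (G : SignedGraph) → (Fin (m G) → ℤ) → (Fin (n G) → ℤ) → Fin (m G) → ℤ
potentialFlow G κ Y e = κ e * Y (ends G e zero)

incidenceSum : (G : SignedGraph) → (Fin (m G) → ℤ) → Fin (n G) → ℤ
incidenceSum G κ = halfEdgeSum G (λ e _ → κ e)

module _ (G : SignedGraph) (κ : Fin (m G) → ℤ) (Y : Fin (n G) → ℤ) {S : Fin (m G) → Set}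
         (potential : IsPotential G S Y) (supported : ∀ e → S e ⊎ κ e ≡ 0ℤ) where

  inflow-potentialFlow : ∀ e i →
    inflow G (canonicalOrientation G) (potentialFlow G κ Y) e i ≡ Y (ends G e i) * κ e
  inflow-potentialFlow e zero       = *-comm (κ e) (Y (ends G e zero))
  inflow-potentialFlow e (suc zero) =
    trans (farEnd-* (sign G e) (κ e) (Y (ends G e zero)))
          (trans (far (supported e)) (*-comm (κ e) (Y (ends G e (suc zero)))))
    where
    far : S e ⊎ κ e ≡ 0ℤ →
          κ e * farEnd (sign G e) (Y (ends G e zero)) ≡ κ e * Y (ends G e (suc zero))
    far (inj₁ s)   = cong (κ e *_) (sym (potential e s))
    far (inj₂ κ≡0) rewrite κ≡0 = refl

  netFlow-potentialFlow : ∀ v →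
    netFlow G (canonicalOrientation G) (potentialFlow G κ Y) v ≡ Y v * incidenceSum G κ v
  netFlow-potentialFlow v =
    trans (halfEdgeSum-cong G v inflow-potentialFlow) (halfEdgeSum-endpoint G v Y (λ e _ → κ e))

-- Colour classes of a 1-factorisation

colourDifference : ∀ {E : Set} → (E → Fin 3) → Fin 3 → Fin 3 → E → ℤ
colourDifference φ p q e = + ⌊ φ e ≟F p ⌋ℕ - + ⌊ φ e ≟F q ⌋ℕ

colourDifference-support : ∀ {G} (φ : Fin (m G) → Fin 3) p q e →
                           In2Factor {G} φ p q e ⊎ colourDifference φ p q e ≡ 0ℤ
colourDifference-support φ p q e with φ e ≟F p | φ e ≟F q
... | yes φe≡p | _        = inj₁ (inj₁ φe≡p)
... | no  _    | yes φe≡q = inj₁ (inj₂ φe≡q)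
... | no  _    | no  _    = inj₂ refl

indicator-difference : ∀ {A P Q : Set} (a? : Dec A) (p? : Dec P) (q? : Dec Q) →
  (if ⌊ a? ⌋ᵇ then + ⌊ p? ⌋ℕ - + ⌊ q? ⌋ℕ else 0ℤ) ≡
  + (if ⌊ p? ⌋ᵇ then ⌊ a? ⌋ℕ else 0) - + (if ⌊ q? ⌋ᵇ then ⌊ a? ⌋ℕ else 0)
indicator-difference (yes _) (yes _) (yes _) = refl
indicator-difference (yes _) (yes _) (no  _) = refl
indicator-difference (yes _) (no  _) (yes _) = refl
indicator-difference (yes _) (no  _) (no  _) = refl
indicator-difference (no  _) (yes _) (yes _) = refl
indicator-difference (no  _) (yes _) (no  _) = refl
indicator-difference (no  _) (no  _) (yes _) = refl
indicator-difference (no  _) (no  _) (no  _) = refl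

incidenceSum-colourDifference : ∀ {G} (φ : Fin (m G) → Fin 3) p q v →
  incidenceSum G (colourDifference φ p q) v ≡
  + halfEdgesAt G (λ e → ⌊ φ e ≟F p ⌋ᵇ) v - + halfEdgesAt G (λ e → ⌊ φ e ≟F q ⌋ᵇ) v
incidenceSum-colourDifference {G} φ p q v =
  trans (Σℤ-cong (m G) λ e →
           trans (Σℤ-cong 2 λ i → indicator-difference (ends G e i ≟F v) (φ e ≟F p) (φ e ≟F q))
                 (Σℤ-difference 2 (count p e) (count q e)))
        (Σℤ-difference (m G) (λ e → Σℕ 2 (count p e)) (λ e → Σℕ 2 (count q e)))
  where
  count : Fin 3 → Fin (m G) → Fin 2 → ℕ
  count r e i = if ⌊ φ e ≟F r ⌋ᵇ then ⌊ ends G e i ≟F v ⌋ℕ else 0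

incidenceSum-oneFactorisation : ∀ G (φ : Fin (m G) → Fin 3) → OneFactorisation G φ →
                                ∀ p q v → incidenceSum G (colourDifference φ p q) v ≡ 0ℤ
incidenceSum-oneFactorisation G φ oneF p q v =
  trans (incidenceSum-colourDifference {G} φ p q v)
        (cong₂ (λ x y → + x - + y) (oneF p v) (oneF q v))

distinct⇒covers-Fin3 : ∀ (a b c x : Fin 3) → a ≢ b → a ≢ c → b ≢ c →
                       x ≡ a ⊎ x ≡ b ⊎ x ≡ c
distinct⇒covers-Fin3 = from-yes (all? {3} λ a → all? {3} λ b → all? {3} λ c → all? {3} λ x →
  ¬? (a ≟F b) →-dec ¬? (a ≟F c) →-dec ¬? (b ≟F c) →-dec
  (x ≟F a ⊎-dec x ≟F b ⊎-dec x ≟F c))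

data EdgeWeights : ℤ → ℤ → Set where
  colour-a : EdgeWeights 1ℤ 1ℤ
  colour-b : EdgeWeights -1ℤ 0ℤ
  colour-c : EdgeWeights 0ℤ -1ℤ

edgeWeights : ∀ {E : Set} {a b c : Fin 3} → a ≢ b → a ≢ c → b ≢ c → (φ : E → Fin 3) → ∀ e →
              EdgeWeights (colourDifference φ a b e) (colourDifference φ a c e)
edgeWeights {a = a} {b} {c} a≢b a≢c b≢c φ e with φ e ≟F a | φ e ≟F b | φ e ≟F c
... | yes _     | no _      | no _      = colour-a
... | no _      | yes _     | no _      = colour-b
... | no _      | no _      | yes _     = colour-c
... | yes ≡a    | yes ≡b    | _         = ⊥-elim (a≢b (trans (sym ≡a) ≡b))
... | yes ≡a    | _         | yes ≡c    = ⊥-elim (a≢c (trans (sym ≡a) ≡c))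
... | _         | yes ≡b    | yes ≡c    = ⊥-elim (b≢c (trans (sym ≡b) ≡c))
... | no ≢a     | no ≢b     | no ≢c     =
  ⊥-elim ([ ≢a , [ ≢b , ≢c ]′ ]′ (distinct⇒covers-Fin3 a b c (φ e) a≢b a≢c b≢c))

±1 : Parity → ℤ
±1 0ℙ = 1ℤ
±1 1ℙ = -1ℤ

edgeValue-admissible : ∀ {k l} → EdgeWeights k l → ∀ p q →
  let w = k * ±1 p + + 2 * (l * ±1 q) in w ≢ 0ℤ × ∣ w ∣ < 4
edgeValue-admissible colour-a 0ℙ 0ℙ = (λ ()) , ≤ᵇ⇒≤ _ _ _
edgeValue-admissible colour-a 0ℙ 1ℙ = (λ ()) , ≤ᵇ⇒≤ _ _ _
edgeValue-admissible colour-a 1ℙ 0ℙ = (λ ()) , ≤ᵇ⇒≤ _ _ _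
edgeValue-admissible colour-a 1ℙ 1ℙ = (λ ()) , ≤ᵇ⇒≤ _ _ _
edgeValue-admissible colour-b 0ℙ q  = (λ ()) , ≤ᵇ⇒≤ _ _ _
edgeValue-admissible colour-b 1ℙ q  = (λ ()) , ≤ᵇ⇒≤ _ _ _
edgeValue-admissible colour-c p  0ℙ = (λ ()) , ≤ᵇ⇒≤ _ _ _
edgeValue-admissible colour-c p  1ℙ = (λ ()) , ≤ᵇ⇒≤ _ _ _

bit : Bool → Parity
bit false = 0ℙ
bit true  = 1ℙ

bit-apart : ∀ {x y} → x ≢ y → bit x ⊕ bit y ≡ 1ℙ
bit-apart {false} {false} x≢y = ⊥-elim (x≢y refl)
bit-apart {false} {true}  _   = refl
bit-apart {true}  {false} _   = refl
bit-apart {true}  {true}  x≢y = ⊥-elim (x≢y refl)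

±1-farEnd : ∀ s p q → p ⊕ q ≡ signParity s ⊕ 1ℙ → ±1 q ≡ farEnd s (±1 p)
±1-farEnd pos 0ℙ 1ℙ _ = refl
±1-farEnd pos 1ℙ 0ℙ _ = refl
±1-farEnd neg 0ℙ 0ℙ _ = refl
±1-farEnd neg 1ℙ 1ℙ _ = refl
±1-farEnd pos 0ℙ 0ℙ ()
±1-farEnd pos 1ℙ 1ℙ ()
±1-farEnd neg 0ℙ 1ℙ ()
±1-farEnd neg 1ℙ 0ℙ ()

twisted : (G : SignedGraph) → Bipartite G → (Fin (n G) → Parity) → Fin (n G) → Parity
twisted G (colour , _) π v = π v ⊕ bit (colour v)

switching⇒potential : ∀ G {S} (β : Bipartite G) π → Switching G S π →
                      IsPotential G S (±1 ∘ twisted G β π)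
switching⇒potential G β@(colour , bipartite) π switching e s =
  ±1-farEnd (sign G e) (twisted G β π u) (twisted G β π v) (begin
    (π u ⊕ bit (colour u)) ⊕ (π v ⊕ bit (colour v)) ≡⟨ ⊕-interchange (π u) _ (π v) _ ⟩
    (π u ⊕ π v) ⊕ (bit (colour u) ⊕ bit (colour v)) ≡⟨ cong₂ _⊕_ (switching e s)
                                                                  (bit-apart (bipartite e)) ⟩
    signParity (sign G e) ⊕ 1ℙ                      ∎)
  where
  open ≡-Reasoning
  u = ends G e zero
  v = ends G e (suc zero)

balanced⇒potential : ∀ G {S} → Bipartite G → Decidable S → BalancedSub G S →
                     Σ (Fin (n G) → Parity) λ ρ → IsPotential G S (±1 ∘ ρ)
balanced⇒potential G {S} β S? balanced =
  let π , switching = balanced⇒switching G S S? balanced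
  in twisted G β π , switching⇒potential G β π switching

in2Factor? : ∀ G (φ : Fin (m G) → Fin 3) p q → Decidable (In2Factor {G} φ p q)
in2Factor? G φ p q e = φ e ≟F p ⊎-dec φ e ≟F q

twoFactorFlow : (G : SignedGraph) → (Fin (m G) → Fin 3) → (a b c : Fin 3) →
                (Y₁ Y₂ : Fin (n G) → ℤ) → Fin (m G) → ℤ
twoFactorFlow G φ a b c Y₁ Y₂ e =
  potentialFlow G (colourDifference φ a b) Y₁ e + + 2 * potentialFlow G (colourDifference φ a c) Y₂ e

module _ (G : SignedGraph) (φ : Fin (m G) → Fin 3) (a b c : Fin 3) where

  twoFactorFlow-conserved : ∀ Y₁ Y₂ → OneFactorisation G φ →
    IsPotential G (In2Factor {G} φ a b) Y₁ → IsPotential G (In2Factor {G} φ a c) Y₂ →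
    ∀ v → netFlow G (canonicalOrientation G) (twoFactorFlow G φ a b c Y₁ Y₂) v ≡ 0ℤ
  twoFactorFlow-conserved Y₁ Y₂ oneF pot₁ pot₂ v = begin
    netFlow G τ (twoFactorFlow G φ a b c Y₁ Y₂) v
      ≡⟨ netFlow-+ G τ f₁ (λ e → + 2 * f₂ e) v ⟩
    netFlow G τ f₁ v + netFlow G τ (λ e → + 2 * f₂ e) v
      ≡⟨ cong (_+_ (netFlow G τ f₁ v)) (netFlow-* G τ (+ 2) f₂ v) ⟩
    netFlow G τ f₁ v + + 2 * netFlow G τ f₂ v
      ≡⟨ cong₂ (λ x y → x + + 2 * y)
               (netFlow-potentialFlow G κ₁ Y₁ pot₁ (colourDifference-support {G} φ a b) v)
               (netFlow-potentialFlow G κ₂ Y₂ pot₂ (colourDifference-support {G} φ a c) v) ⟩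
    Y₁ v * incidenceSum G κ₁ v + + 2 * (Y₂ v * incidenceSum G κ₂ v)
      ≡⟨ cong₂ (λ x y → Y₁ v * x + + 2 * (Y₂ v * y))
               (incidenceSum-oneFactorisation G φ oneF a b v)
               (incidenceSum-oneFactorisation G φ oneF a c v) ⟩
    Y₁ v * 0ℤ + + 2 * (Y₂ v * 0ℤ)
      ≡⟨ cong₂ (λ x y → x + + 2 * y) (*-zeroʳ (Y₁ v)) (*-zeroʳ (Y₂ v)) ⟩
    0ℤ ∎
    where
    open ≡-Reasoning
    τ = canonicalOrientation G
    κ₁ = colourDifference φ a b
    κ₂ = colourDifference φ a c
    f₁ = potentialFlow G κ₁ Y₁
    f₂ = potentialFlow G κ₂ Y₂

  twoFactorFlow-nowhereZero : a ≢ b → a ≢ c → b ≢ c → ∀ (ρ₁ ρ₂ : Fin (n G) → Parity) e →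
    let w = twoFactorFlow G φ a b c (±1 ∘ ρ₁) (±1 ∘ ρ₂) e in w ≢ 0ℤ × ∣ w ∣ < 4
  twoFactorFlow-nowhereZero a≢b a≢c b≢c ρ₁ ρ₂ e =
    edgeValue-admissible (edgeWeights a≢b a≢c b≢c φ e) (ρ₁ (ends G e zero)) (ρ₂ (ends G e zero))

mainTheorem1 : (G : SignedGraph) → Cubic G → Bipartite G →
    (φ : Fin (m G) → Fin 3) → OneFactorisation G φ →
    (a b c : Fin 3) → a ≢ b → a ≢ c → b ≢ c →
    BalancedSub G (In2Factor {G} φ a b) → BalancedSub G (In2Factor {G} φ a c) →
    NowhereZeroFlow G 4
mainTheorem1 G _ β φ oneF a b c a≢b a≢c b≢c balanced₁ balanced₂
  with balanced⇒potential G β (in2Factor? G φ a b) balanced₁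
     | balanced⇒potential G β (in2Factor? G φ a c) balanced₂
... | ρ₁ , potential₁ | ρ₂ , potential₂ =
  canonicalOrientation G , twoFactorFlow G φ a b c (±1 ∘ ρ₁) (±1 ∘ ρ₂) ,
  canonicalOrientation-valid G ,
  twoFactorFlow-nowhereZero G φ a b c a≢b a≢c b≢c ρ₁ ρ₂ ,
  twoFactorFlow-conserved G φ a b c (±1 ∘ ρ₁) (±1 ∘ ρ₂) oneF potential₁ potential₂
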